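{- Let $n\geq 3$ and $r\geq 2$ be integers. Then: (i) if $n\geq 4$ is even, the cycle $C_n$ is $(2r,r)$-star colorable; (ii) if $n\geq 2r+1$ is odd, $C_n$ is $(2r+1,r)$-star colorable; (iii) if $n\geq 3$ is odd, $C_n$ is $\left(2r+\left\lceil \frac{2r}{n-1}\right\rceil,r\right)$-star colorable.
   Context: $C_n$ denotes the cycle on $n$ vertices. A star edge coloring of a graph is a proper edge coloring such that no path or cycle with four edges uses at most two colors. For an edge coloring $f$ and a vertex $v$, $A_f(v)$ denotes the set of colors of edges incident to $v$. Two star edge colorings $f_1,f_2$ of $G$ are star compatible if $A_{f_1}(v)\cap A_{f_2}(v)=\emptyset$ for every vertex $v$. $G$ is $(k,t)$-star colorable if $G$ has $t$ pairwise star compatible star edge colorings $f_i:E(G)\to\{0,1,\ldots,k-1\}$, $1\le i\le t$. -}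

module Defs where

open import Data.Nat using (ℕ; zero; suc; _+_)
open import Data.Nat.DivMod using (_mod_; _/_)
open import Data.Fin using (Fin; toℕ)
open import Data.Product using (_×_; _,_; Σ; ∃-syntax; proj₁; proj₂)
open import Data.Sum using (_⊎_)
open import Relation.Binary.PropositionalEquality using (_≡_; _≢_)

record Graph : Set where
  field
    V    : ℕ
    E    : ℕ
    ends : Fin E → Fin V × Fin V
open Graph public

Incident : (G : Graph) → Fin (E G) → Fin (V G) → Set
Incident G e v = proj₁ (ends G e) ≡ v ⊎ proj₂ (ends G e) ≡ v

Joins : (G : Graph) → Fin (E G) → Fin (V G) → Fin (V G) → Set
Joins G e u v = ends G e ≡ (u , v) ⊎ ends G e ≡ (v , u)

EdgeColoring : Graph → ℕ → Set
EdgeColoring G k = Fin (E G) → Fin k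

Proper : (G : Graph) {k : ℕ} → EdgeColoring G k → Set
Proper G f = ∀ (v : Fin (V G)) (e e' : Fin (E G)) →
  Incident G e v → Incident G e' v → e ≢ e' → f e ≢ f e'

record Walk4 (G : Graph) : Set where
  field
    v0 v1 v2 v3 v4 : Fin (V G)
    e1 e2 e3 e4 : Fin (E G)
    j1 : Joins G e1 v0 v1
    j2 : Joins G e2 v1 v2
    j3 : Joins G e3 v2 v3
    j4 : Joins G e4 v3 v4
open Walk4 public

Distinct4 : {G : Graph} → Walk4 G → Set
Distinct4 w = v0 w ≢ v1 w × v0 w ≢ v2 w × v0 w ≢ v3 w
            × v1 w ≢ v2 w × v1 w ≢ v3 w × v2 w ≢ v3 w

IsPath4 : {G : Graph} → Walk4 G → Set
IsPath4 w = Distinct4 w × v4 w ≢ v0 w × v4 w ≢ v1 w × v4 w ≢ v2 w × v4 w ≢ v3 w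

-- a cycle with four edges: v0..v3 pairwise distinct and v4 = v0
-- (edges are then automatically distinct in a proper setting; we also require it)
IsCycle4 : {G : Graph} → Walk4 G → Set
IsCycle4 w = Distinct4 w × v4 w ≡ v0 w
           × e1 w ≢ e2 w × e1 w ≢ e3 w × e1 w ≢ e4 w
           × e2 w ≢ e3 w × e2 w ≢ e4 w × e3 w ≢ e4 w

AtMostTwoColors : (G : Graph) {k : ℕ} → EdgeColoring G k → Walk4 G → Set
AtMostTwoColors G {k} f w = ∃[ a ] ∃[ b ]
  ((f (e1 w) ≡ a ⊎ f (e1 w) ≡ b) × (f (e2 w) ≡ a ⊎ f (e2 w) ≡ b) ×
   (f (e3 w) ≡ a ⊎ f (e3 w) ≡ b) × (f (e4 w) ≡ a ⊎ f (e4 w) ≡ b))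

StarEdgeColoring : (G : Graph) {k : ℕ} → EdgeColoring G k → Set
StarEdgeColoring G f = Proper G f ×
  (∀ (w : Walk4 G) → (IsPath4 w ⊎ IsCycle4 w) → AtMostTwoColors G f w → Data.Empty.⊥)
  where import Data.Empty

StarCompatible : (G : Graph) {k : ℕ} → EdgeColoring G k → EdgeColoring G k → Set
StarCompatible G f₁ f₂ = ∀ (v : Fin (V G)) (e e' : Fin (E G)) →
  Incident G e v → Incident G e' v → f₁ e ≢ f₂ e'

StarColorable : Graph → ℕ → ℕ → Set
StarColorable G k t = Σ (Fin t → EdgeColoring G k) λ fs →
  (∀ i → StarEdgeColoring G (fs i)) ×
  (∀ i j → i ≢ j → StarCompatible G (fs i) (fs j))

next : {n : ℕ} → Fin n → Fin n
next {suc m} i = suc (toℕ i) mod suc m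

Cycle : ℕ → Graph
Cycle n = record { V = n ; E = n ; ends = λ i → (i , next i) }

-- ⌈ a / b ⌉ for b ≥ 1 (value at b = 0 irrelevant)
ceilDiv : ℕ → ℕ → ℕ
ceilDiv a zero = zero
ceilDiv a (suc b) = (a + b) / suc b

module Submission where

-- An edge colouring of C_n is a word of length n read cyclically.  Compatible words come from shifting:
-- if a star word moves by steps ±1 around ℤ/K, its shifts by 0, 2, …, 2r-2
-- (mod K) are pairwise compatible when 2r ≤ K, by a parity argument.  Part
-- (i) shifts the zigzag 0 1 2 1 … on K = 2r colours; part (ii) shifts a word
-- climbing 0 … 2r and then zigzagging, on K = 2r+1 colours, except for
-- n = 2r+3, which needs layer-dependent words.  Part (iii), for n = 2q+1,
-- adds blocks of q layers from part (ii) by induction on r, starting from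
-- r ≤ q+1 (part (ii), an explicit pentagon family checked by computation,
-- or two part (ii) families) and from disjoint rainbow triangles when n = 3.

open import Defs
open import Data.Nat
  using (ℕ; zero; suc; _+_; _*_; _∸_; _≤_; _<_; z≤n; s≤s; NonZero; _<?_; _≤?_; _≟_)
open import Data.Nat.Properties
open import Data.Nat.DivMod
open import Data.Nat.Tactic.RingSolver using (solve-∀)
open import Data.Nat.Induction using (<-rec)
open import Data.Fin using (Fin; toℕ; fromℕ<)
open import Data.Fin.Properties using (toℕ<n; toℕ-fromℕ<; toℕ-injective)
open import Data.Unit using (tt)
open import Data.Product using (_×_; _,_; proj₁; proj₂; Σ; uncurry)
open import Data.Sum using (_⊎_; inj₁; inj₂)
open import Data.Empty using (⊥; ⊥-elim)
open import Relation.Nullary using (¬_; Dec; yes; no)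
open import Relation.Nullary.Decidable using (map′; ¬?; _×-dec_; _→-dec_; toWitness)
open import Relation.Binary.PropositionalEquality

-- The colours a b c d of four consecutive edges do not alternate a b a b.
NoAlternation : {A : Set} → A → A → A → A → Set
NoAlternation a b c d = a ≡ c → b ≡ d → ⊥

-- A vertex lying between edges a and b sees the colours {f a, f b} in one
-- colouring and {g a, g b} in another; compatibility asks them to be disjoint.
DisjointAt : {I A : Set} → (I → A) → (I → A) → I → I → Set
DisjointAt f g a b = (f a ≢ g a) × (f a ≢ g b) × (f b ≢ g a) × (f b ≢ g b)

-- f, read on the positions 0 … m+2, is a star edge colouring of C_(m+3):
-- consecutive edges differ and no four consecutive edges alternate.
record StarWord (m : ℕ) (f : ℕ → ℕ) : Set where
  field
    properAlong  : ∀ e → suc e < 3 + m → f e ≢ f (suc e)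
    properAround : f (2 + m) ≢ f 0
    starAlong    : ∀ e → 3 + e < 3 + m → NoAlternation (f e) (f (1 + e)) (f (2 + e)) (f (3 + e))
    starAround₁  : NoAlternation (f m) (f (1 + m)) (f (2 + m)) (f 0)
    starAround₂  : NoAlternation (f (1 + m)) (f (2 + m)) (f 0) (f 1)
    starAround₃  : NoAlternation (f (2 + m)) (f 0) (f 1) (f 2)

record CompatibleWords (m : ℕ) (f g : ℕ → ℕ) : Set where
  field
    disjointAlong  : ∀ e → suc e < 3 + m → DisjointAt f g e (suc e)
    disjointAround : DisjointAt f g (2 + m) 0

record WordFamily (m k t : ℕ) : Set where
  field
    word       : ℕ → ℕ → ℕ
    bounded    : ∀ i e → i < t → e < 3 + m → word i e < k
    star       : ∀ i → i < t → StarWord m (word i)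
    compatible : ∀ i j → i < t → j < t → i ≢ j → CompatibleWords m (word i) (word j)

-- Four colours with consecutive ones distinct, all drawn from {a, b}, must
-- alternate: this is why a bicoloured path or cycle contradicts NoAlternation.
alternates : ∀ {A : Set} {x₁ x₂ x₃ x₄ a b : A} →
             (x₁ ≡ a ⊎ x₁ ≡ b) → (x₂ ≡ a ⊎ x₂ ≡ b) → (x₃ ≡ a ⊎ x₃ ≡ b) → (x₄ ≡ a ⊎ x₄ ≡ b) →
             x₁ ≢ x₂ → x₂ ≢ x₃ → x₃ ≢ x₄ → x₁ ≡ x₃ × x₂ ≡ x₄
alternates (inj₁ refl) (inj₁ refl) _ _ x₁≢x₂ _ _ = ⊥-elim (x₁≢x₂ refl)
alternates (inj₂ refl) (inj₂ refl) _ _ x₁≢x₂ _ _ = ⊥-elim (x₁≢x₂ refl)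
alternates _ (inj₁ refl) (inj₁ refl) _ _ x₂≢x₃ _ = ⊥-elim (x₂≢x₃ refl)
alternates _ (inj₂ refl) (inj₂ refl) _ _ x₂≢x₃ _ = ⊥-elim (x₂≢x₃ refl)
alternates _ _ (inj₁ refl) (inj₁ refl) _ _ x₃≢x₄ = ⊥-elim (x₃≢x₄ refl)
alternates _ _ (inj₂ refl) (inj₂ refl) _ _ x₃≢x₄ = ⊥-elim (x₃≢x₄ refl)
alternates (inj₁ refl) (inj₂ refl) (inj₁ refl) (inj₂ refl) _ _ _ = refl , refl
alternates (inj₂ refl) (inj₁ refl) (inj₂ refl) (inj₁ refl) _ _ _ = refl , refl

distinct : ∀ {G} {w : Walk4 G} → IsPath4 w ⊎ IsCycle4 w → Distinct4 w
distinct (inj₁ path) = proj₁ path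
distinct (inj₂ cycle) = proj₁ cycle

v2≢v4 : ∀ {G} {w : Walk4 G} → IsPath4 w ⊎ IsCycle4 w → v2 w ≢ v4 w
v2≢v4 (inj₁ (_ , _ , _ , v4≢v2 , _)) eq = v4≢v2 (sym eq)
v2≢v4 (inj₂ ((_ , v0≢v2 , _) , v4≡v0 , _)) eq = v0≢v2 (sym (trans eq v4≡v0))

module Around (m : ℕ) where

  around : ℕ → ℕ
  around e = suc e % (3 + m)

  around-along : ∀ e → suc e < 3 + m → around e ≡ suc e
  around-along e = m<n⇒m%n≡m

  around-last : around (2 + m) ≡ 0
  around-last = n%n≡0 (3 + m)

  around-cases : ∀ e → e < 3 + m →
                 (suc e < 3 + m × around e ≡ suc e) ⊎ (e ≡ 2 + m × around e ≡ 0)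
  around-cases e e< with m≤n⇒m<n∨m≡n e<
  ... | inj₁ e+1< = inj₁ (e+1< , around-along e e+1<)
  ... | inj₂ refl = inj₂ (refl , around-last)

  around-injective : ∀ x y → x < 3 + m → y < 3 + m → around x ≡ around y → x ≡ y
  around-injective x y x< y< eq with around-cases x x< | around-cases y y<
  ... | inj₁ (_ , ax) | inj₁ (_ , ay) = suc-injective (trans (sym ax) (trans eq ay))
  ... | inj₁ (_ , ax) | inj₂ (_ , ay) = ⊥-elim (1+n≢0 (trans (sym ax) (trans eq ay)))
  ... | inj₂ (_ , ax) | inj₁ (_ , ay) = ⊥-elim (1+n≢0 (trans (sym ay) (trans (sym eq) ax)))
  ... | inj₂ (x≡ , _) | inj₂ (y≡ , _) = trans x≡ (sym y≡)

  -- Where a run of four consecutive edges starting at e meets the wrap-around.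
  data Position : ℕ → Set where
    inner      : ∀ {e} → 3 + e < 3 + m → Position e
    thirdLast  : Position m
    secondLast : Position (1 + m)
    last       : Position (2 + m)

  position : ∀ e → e < 3 + m → Position e
  position e e< with e <? m
  ... | yes e<m = inner (+-monoʳ-< 3 e<m)
  ... | no e≮m with m≤n⇒∃[o]m+o≡n (≮⇒≥ e≮m)
  ... | 0 , refl = subst Position (sym (+-identityʳ m)) thirdLast
  ... | 1 , refl = subst Position (+-comm 1 m) secondLast
  ... | 2 , refl = subst Position (+-comm 2 m) last
  ... | suc (suc (suc d)) , refl = ⊥-elim (<⇒≱ (s≤s 3+m≤e) e<)
    where
    3+m≤e : 3 + m ≤ m + (3 + d)
    3+m≤e = ≤-trans (≤-reflexive (+-comm 3 m)) (+-monoʳ-≤ m (m≤m+n 3 d))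

  module _ {f : ℕ → ℕ} (W : StarWord m f) where
    open StarWord W

    properCyclic : ∀ e → e < 3 + m → f e ≢ f (around e)
    properCyclic e e< with around-cases e e<
    ... | inj₁ (e+1< , eq) rewrite eq = properAlong e e+1<
    ... | inj₂ (refl , eq) rewrite eq = properAround

    starCyclic : ∀ e → e < 3 + m →
                 NoAlternation (f e) (f (around e)) (f (around (around e))) (f (around (around (around e))))
    starCyclic e e< with position e e<
    ... | inner 3+e<
      rewrite around-along e (<-trans (n<1+n _) (<-trans (n<1+n _) 3+e<))
            | around-along (1 + e) (<-trans (n<1+n _) 3+e<)
            | around-along (2 + e) 3+e< = starAlong e 3+e<
    ... | thirdLast
      rewrite around-along m (s≤s (n≤1+n _)) | around-along (1 + m) ≤-refl
            | around-last = starAround₁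
    ... | secondLast
      rewrite around-along (1 + m) ≤-refl | around-last | around-along 0 (s≤s (s≤s z≤n)) = starAround₂
    ... | last
      rewrite around-last | around-along 0 (s≤s (s≤s z≤n))
            | around-along 1 (s≤s (s≤s (s≤s z≤n))) = starAround₃

  disjointCyclic : ∀ {f g} → CompatibleWords m f g → ∀ e → e < 3 + m → DisjointAt f g e (around e)
  disjointCyclic C e e< with around-cases e e<
  ... | inj₁ (e+1< , eq) rewrite eq = CompatibleWords.disjointAlong C e e+1<
  ... | inj₂ (refl , eq) rewrite eq = CompatibleWords.disjointAround C

  toℕ-next : (x : Fin (3 + m)) → toℕ (next x) ≡ around (toℕ x)
  toℕ-next x = toℕ-fromℕ< _

  next-injective : (x y : Fin (3 + m)) → next x ≡ next y → x ≡ y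
  next-injective x y eq = toℕ-injective (around-injective (toℕ x) (toℕ y) (toℕ<n x) (toℕ<n y)
                            (trans (sym (toℕ-next x)) (trans (cong toℕ eq) (toℕ-next y))))

  module _ {f : ℕ → ℕ} (W : StarWord m f) where
    properAt : (x : Fin (3 + m)) → f (toℕ x) ≢ f (toℕ (next x))
    properAt x rewrite toℕ-next x = properCyclic W (toℕ x) (toℕ<n x)

    starAt : (x : Fin (3 + m)) →
             NoAlternation (f (toℕ x)) (f (toℕ (next x))) (f (toℕ (next (next x)))) (f (toℕ (next (next (next x)))))
    starAt x rewrite toℕ-next (next (next x)) | toℕ-next (next x) | toℕ-next x =
      starCyclic W (toℕ x) (toℕ<n x)

  disjointAt : ∀ {f g} → CompatibleWords m f g → (x : Fin (3 + m)) →
               DisjointAt (λ y → f (toℕ y)) (λ y → g (toℕ y)) x (next x)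
  disjointAt C x rewrite toℕ-next x = disjointCyclic C (toℕ x) (toℕ<n x)

  properFromSteps : ∀ {k} (f : EdgeColoring (Cycle (3 + m)) k) →
                    (∀ x → f x ≢ f (next x)) → Proper (Cycle (3 + m)) f
  properFromSteps f step v e e' (inj₁ refl) (inj₁ refl) e≢e' _ = e≢e' refl
  properFromSteps f step v e e' (inj₁ refl) (inj₂ e'→e) _ eq = step e' (trans (sym eq) (cong f (sym e'→e)))
  properFromSteps f step v e e' (inj₂ e→e') (inj₁ refl) _ eq = step e (trans eq (cong f (sym e→e')))
  properFromSteps f step v e e' (inj₂ p) (inj₂ q) e≢e' _ = e≢e' (next-injective e e' (trans p (sym q)))

  Forward Backward : Fin (3 + m) → Fin (3 + m) → Fin (3 + m) → Set
  Forward e u v = e ≡ u × next e ≡ v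
  Backward e u v = e ≡ v × next e ≡ u

  direction : ∀ {e u v} → Joins (Cycle (3 + m)) e u v → Forward e u v ⊎ Backward e u v
  direction (inj₁ p) = inj₁ (cong proj₁ p , cong proj₂ p)
  direction (inj₂ p) = inj₂ (cong proj₁ p , cong proj₂ p)

  SameDirection : Fin (3 + m) → Fin (3 + m) → Fin (3 + m) → Fin (3 + m) → Fin (3 + m) → Set
  SameDirection e e' u₀ u₁ u₂ = (Forward e u₀ u₁ × Forward e' u₁ u₂) ⊎ (Backward e u₀ u₁ × Backward e' u₁ u₂)

  sameDirection : ∀ {e e' u₀ u₁ u₂} → u₀ ≢ u₂ →
                  Forward e u₀ u₁ ⊎ Backward e u₀ u₁ → Forward e' u₁ u₂ ⊎ Backward e' u₁ u₂ →
                  SameDirection e e' u₀ u₁ u₂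
  sameDirection _ (inj₁ s) (inj₁ s') = inj₁ (s , s')
  sameDirection _ (inj₂ s) (inj₂ s') = inj₂ (s , s')
  sameDirection u₀≢u₂ (inj₁ (refl , p)) (inj₂ (refl , q)) = ⊥-elim (u₀≢u₂ (next-injective _ _ (trans p (sym q))))
  sameDirection u₀≢u₂ (inj₂ (refl , p)) (inj₁ (refl , q)) = ⊥-elim (u₀≢u₂ (trans (sym p) q))

  data Consecutive (a b c d : Fin (3 + m)) : Set where
    forward  : b ≡ next a → c ≡ next b → d ≡ next c → Consecutive a b c d
    backward : a ≡ next b → b ≡ next c → c ≡ next d → Consecutive a b c d

  consecutive : (w : Walk4 (Cycle (3 + m))) → Distinct4 w → v2 w ≢ v4 w →
                Consecutive (e1 w) (e2 w) (e3 w) (e4 w)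
  consecutive w (_ , v0≢v2 , _ , v1≢v2 , v1≢v3 , v2≢v3) v2≢v4 =
    combine (sameDirection v0≢v2 (direction (j1 w)) (direction (j2 w)))
            (sameDirection v1≢v3 (direction (j2 w)) (direction (j3 w)))
            (sameDirection v2≢v4 (direction (j3 w)) (direction (j4 w)))
    where
    combine : SameDirection (e1 w) (e2 w) (v0 w) (v1 w) (v2 w) →
              SameDirection (e2 w) (e3 w) (v1 w) (v2 w) (v3 w) →
              SameDirection (e3 w) (e4 w) (v2 w) (v3 w) (v4 w) → Consecutive (e1 w) (e2 w) (e3 w) (e4 w)
    combine (inj₁ ((_ , r₁) , (q₂ , r₂))) (inj₁ (_ , (q₃ , r₃))) (inj₁ (_ , (q₄ , _))) =
      forward (trans q₂ (sym r₁)) (trans q₃ (sym r₂)) (trans q₄ (sym r₃))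
    combine (inj₂ ((q₁ , _) , (q₂ , r₂))) (inj₂ (_ , (q₃ , r₃))) (inj₂ (_ , (_ , r₄))) =
      backward (trans q₁ (sym r₂)) (trans q₂ (sym r₃)) (trans q₃ (sym r₄))
    combine (inj₁ (_ , (q₂ , _))) (inj₂ ((q₂' , _) , _)) _ = ⊥-elim (v1≢v2 (trans (sym q₂) q₂'))
    combine (inj₂ (_ , (q₂ , _))) (inj₁ ((q₂' , _) , _)) _ = ⊥-elim (v1≢v2 (trans (sym q₂') q₂))
    combine _ (inj₁ (_ , (q₃ , _))) (inj₂ ((q₃' , _) , _)) = ⊥-elim (v2≢v3 (trans (sym q₃) q₃'))
    combine _ (inj₂ (_ , (q₃ , _))) (inj₁ ((q₃' , _) , _)) = ⊥-elim (v2≢v3 (trans (sym q₃') q₃))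

  starFromSteps : ∀ {k} (f : EdgeColoring (Cycle (3 + m)) k) →
                  (∀ x → f x ≢ f (next x)) →
                  (∀ x → NoAlternation (f x) (f (next x)) (f (next (next x))) (f (next (next (next x))))) →
                  StarEdgeColoring (Cycle (3 + m)) f
  starFromSteps f step noAlt = properFromSteps f step , noBicolouredWalk
    where
    forwardStep : ∀ {a b} → b ≡ next a → f a ≢ f b
    forwardStep p h = step _ (trans h (cong f p))
    backwardStep : ∀ {a b} → a ≡ next b → f a ≢ f b
    backwardStep p h = step _ (trans (sym h) (cong f p))

    fromForward : ∀ {a b c d} → b ≡ next a → c ≡ next b → d ≡ next c → f a ≡ f c → f b ≡ f d → ⊥
    fromForward {a} refl refl refl = noAlt a
    fromBackward : ∀ {a b c d} → a ≡ next b → b ≡ next c → c ≡ next d → f a ≡ f c → f b ≡ f d → ⊥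
    fromBackward {d = d} refl refl refl fa≡fc fb≡fd = noAlt d (sym fb≡fd) (sym fa≡fc)

    noBicolouredWalk : ∀ w → IsPath4 w ⊎ IsCycle4 w → AtMostTwoColors (Cycle (3 + m)) f w → ⊥
    noBicolouredWalk w path-or-cycle (_ , _ , c₁ , c₂ , c₃ , c₄)
      with consecutive w (distinct {w = w} path-or-cycle) (v2≢v4 {w = w} path-or-cycle)
    ... | forward p q r =
      uncurry (fromForward p q r) (alternates c₁ c₂ c₃ c₄ (forwardStep p) (forwardStep q) (forwardStep r))
    ... | backward p q r =
      uncurry (fromBackward p q r) (alternates c₁ c₂ c₃ c₄ (backwardStep p) (backwardStep q) (backwardStep r))

  compatFromSteps : ∀ {k} (f g : EdgeColoring (Cycle (3 + m)) k) →
                    (∀ x → DisjointAt f g x (next x)) → StarCompatible (Cycle (3 + m)) f g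
  compatFromSteps f g disj v e e' (inj₁ refl) (inj₁ refl) = proj₁ (disj e)
  compatFromSteps f g disj v e e' (inj₁ refl) (inj₂ e'→e) h =
    proj₁ (proj₂ (proj₂ (disj e'))) (trans (cong f e'→e) h)
  compatFromSteps f g disj v e e' (inj₂ e→e') (inj₁ refl) h =
    proj₁ (proj₂ (disj e)) (trans h (cong g (sym e→e')))
  compatFromSteps f g disj v e e' (inj₂ p) (inj₂ q) h =
    proj₁ (disj e) (trans h (cong g (sym (next-injective e e' (trans p (sym q))))))

realise : ∀ {m k t} → WordFamily m k t → StarColorable (Cycle (3 + m)) k t
realise {m} {k} {t} W = colouring , (λ i → starFromSteps (colouring i) (proper i) (noAlt i)) , compat
  where
  open WordFamily W
  open Around m

  colouring : Fin t → EdgeColoring (Cycle (3 + m)) k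
  colouring i x = fromℕ< (bounded (toℕ i) (toℕ x) (toℕ<n i) (toℕ<n x))

  reflect : ∀ {i j x y} → colouring i x ≡ colouring j y → word (toℕ i) (toℕ x) ≡ word (toℕ j) (toℕ y)
  reflect eq = trans (sym (toℕ-fromℕ< _)) (trans (cong toℕ eq) (toℕ-fromℕ< _))

  proper : ∀ i x → colouring i x ≢ colouring i (next x)
  proper i x eq = properAt (star (toℕ i) (toℕ<n i)) x (reflect eq)

  noAlt : ∀ i x → NoAlternation (colouring i x) (colouring i (next x))
                                (colouring i (next (next x))) (colouring i (next (next (next x))))
  noAlt i x h₁ h₂ = starAt (star (toℕ i) (toℕ<n i)) x (reflect h₁) (reflect h₂)

  compat : ∀ i j → i ≢ j → StarCompatible (Cycle (3 + m)) (colouring i) (colouring j)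
  compat i j i≢j = compatFromSteps (colouring i) (colouring j) disjoint
    where
    i≢j' : toℕ i ≢ toℕ j
    i≢j' eq = i≢j (toℕ-injective eq)
    disjoint : ∀ x → DisjointAt (colouring i) (colouring j) x (next x)
    disjoint x with disjointAt (compatible (toℕ i) (toℕ j) (toℕ<n i) (toℕ<n j) i≢j') x
    ... | d₁ , d₂ , d₃ , d₄ =
      (λ h → d₁ (reflect h)) , (λ h → d₂ (reflect h)) , (λ h → d₃ (reflect h)) , (λ h → d₄ (reflect h))

widen : ∀ {m k k' t} → k ≤ k' → WordFamily m k t → WordFamily m k' t
widen k≤k' W = record { WordFamily W ; bounded = λ i e i< e< → ≤-trans (bounded i e i< e<) k≤k' }
  where open WordFamily W

renameStar : ∀ {m} {f : ℕ → ℕ} (φ : ℕ → ℕ) → (∀ a b → φ (f a) ≡ φ (f b) → f a ≡ f b) →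
             StarWord m f → StarWord m (λ e → φ (f e))
renameStar φ inj W = record
  { properAlong  = λ e e< h → properAlong e e< (inj _ _ h)
  ; properAround = λ h → properAround (inj _ _ h)
  ; starAlong    = λ e e< h₁ h₂ → starAlong e e< (inj _ _ h₁) (inj _ _ h₂)
  ; starAround₁  = λ h₁ h₂ → starAround₁ (inj _ _ h₁) (inj _ _ h₂)
  ; starAround₂  = λ h₁ h₂ → starAround₂ (inj _ _ h₁) (inj _ _ h₂)
  ; starAround₃  = λ h₁ h₂ → starAround₃ (inj _ _ h₁) (inj _ _ h₂) }
  where open StarWord W

translateCompatible : ∀ {m} {f g : ℕ → ℕ} (c : ℕ) →
                      CompatibleWords m f g → CompatibleWords m (λ e → c + f e) (λ e → c + g e)
translateCompatible {f = f} {g} c C = record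
  { disjointAlong  = λ e e< → translate (disjointAlong e e<)
  ; disjointAround = translate disjointAround }
  where
  open CompatibleWords C
  translate : ∀ {a b} → DisjointAt f g a b → DisjointAt (λ e → c + f e) (λ e → c + g e) a b
  translate (d₁ , d₂ , d₃ , d₄) = (λ h → d₁ (+-cancelˡ-≡ c _ _ h)) , (λ h → d₂ (+-cancelˡ-≡ c _ _ h))
                                , (λ h → d₃ (+-cancelˡ-≡ c _ _ h)) , (λ h → d₄ (+-cancelˡ-≡ c _ _ h))

compatibleSym : ∀ {m} {f g : ℕ → ℕ} → CompatibleWords m f g → CompatibleWords m g f
compatibleSym {f = f} {g} C = record
  { disjointAlong = λ e e< → swap (disjointAlong e e<) ; disjointAround = swap disjointAround }
  where
  open CompatibleWords C
  swap : ∀ {a b} → DisjointAt f g a b → DisjointAt g f a b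
  swap (d₁ , d₂ , d₃ , d₄) = (λ h → d₁ (sym h)) , (λ h → d₃ (sym h)) , (λ h → d₂ (sym h)) , (λ h → d₄ (sym h))

separated : ∀ {m} {f g : ℕ → ℕ} (k₁ : ℕ) → (∀ e → e < 3 + m → f e < k₁) → CompatibleWords m f (λ e → k₁ + g e)
separated {m} {f} {g} k₁ f< = record
  { disjointAlong  = λ e e+1< → disjoint (f< e (<-trans (n<1+n e) e+1<)) (f< (suc e) e+1<)
  ; disjointAround = disjoint (f< (2 + m) ≤-refl) (f< 0 (s≤s z≤n)) }
  where
  below : ∀ {x y} → x < k₁ → x ≢ k₁ + y
  below {y = y} x< refl = <-irrefl refl (≤-trans x< (m≤m+n k₁ y))
  disjoint : ∀ {a b} → f a < k₁ → f b < k₁ → DisjointAt f (λ e → k₁ + g e) a b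
  disjoint fa< fb< = below fa< , below fa< , below fb< , below fb<

juxtapose : ∀ {m k₁ k₂ t₁ t₂} → WordFamily m k₁ t₁ → WordFamily m k₂ t₂ → WordFamily m (k₁ + k₂) (t₁ + t₂)
juxtapose {m} {k₁} {k₂} {t₁} {t₂} A B = record
  { word = word ; bounded = bounded ; star = star ; compatible = compatible }
  where
  module A = WordFamily A
  module B = WordFamily B

  word : ℕ → ℕ → ℕ
  word i with i <? t₁
  ... | yes _ = A.word i
  ... | no _ = λ e → k₁ + B.word (i ∸ t₁) e

  shifted : ∀ {i} → ¬ i < t₁ → i < t₁ + t₂ → i ∸ t₁ < t₂
  shifted {i} i≮t₁ i< = subst (i ∸ t₁ <_) (m+n∸m≡n t₁ t₂) (∸-monoˡ-< i< (≮⇒≥ i≮t₁))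

  bounded : ∀ i e → i < t₁ + t₂ → e < 3 + m → word i e < k₁ + k₂
  bounded i e i< e< with i <? t₁
  ... | yes i<t₁ = ≤-trans (A.bounded i e i<t₁ e<) (m≤m+n k₁ k₂)
  ... | no i≮t₁ = +-monoʳ-< k₁ (B.bounded (i ∸ t₁) e (shifted i≮t₁ i<) e<)

  star : ∀ i → i < t₁ + t₂ → StarWord m (word i)
  star i i< with i <? t₁
  ... | yes i<t₁ = A.star i i<t₁
  ... | no i≮t₁ = renameStar (k₁ +_) (λ a b → +-cancelˡ-≡ k₁ _ _) (B.star (i ∸ t₁) (shifted i≮t₁ i<))

  compatible : ∀ i j → i < t₁ + t₂ → j < t₁ + t₂ → i ≢ j → CompatibleWords m (word i) (word j)
  compatible i j i< j< i≢j with i <? t₁ | j <? t₁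
  ... | yes i<t₁ | yes j<t₁ = A.compatible i j i<t₁ j<t₁ i≢j
  ... | yes i<t₁ | no _ = separated k₁ (λ e → A.bounded i e i<t₁)
  ... | no _ | yes j<t₁ = compatibleSym (separated k₁ (λ e → A.bounded j e j<t₁))
  ... | no i≮t₁ | no j≮t₁ = translateCompatible k₁
        (B.compatible (i ∸ t₁) (j ∸ t₁) (shifted i≮t₁ i<) (shifted j≮t₁ j<)
           (λ eq → i≢j (∸-cancelʳ-≡ (≮⇒≥ i≮t₁) (≮⇒≥ j≮t₁) eq)))

noWords : ∀ {m k} → WordFamily m k 0
noWords = record { word = λ _ _ → 0 ; bounded = λ _ _ () ; star = λ _ () ; compatible = λ _ _ () }

copies : ∀ {m k} → WordFamily m k 1 → ∀ r → WordFamily m (r * k) r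
copies W zero = noWords
copies W (suc r) = juxtapose W (copies W r)

triangle : WordFamily 0 3 1
triangle = record { word = λ _ e → e ; bounded = λ _ _ _ e< → e< ; star = λ _ _ → rainbow ; compatible = single }
  where
  rainbow : StarWord 0 (λ e → e)
  rainbow = record
    { properAlong  = λ e _ h → <-irrefl h (n<1+n e)
    ; properAround = λ ()
    ; starAlong    = λ { e (s≤s (s≤s (s≤s ()))) }
    ; starAround₁  = λ ()
    ; starAround₂  = λ ()
    ; starAround₃  = λ () }
  single : ∀ i j → i < 1 → j < 1 → i ≢ j → CompatibleWords 0 (λ e → e) (λ e → e)
  single 0 0 _ _ i≢j = ⊥-elim (i≢j refl)
  single (suc _) _ (s≤s ()) _ _
  single 0 (suc _) _ (s≤s ()) _

FamilyOn : ℕ → ℕ → ℕ → Set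
FamilyOn N k t = Σ ℕ λ m → 3 + m ≡ N × WordFamily m k t

realiseOn : ∀ {N k t} → FamilyOn N k t → StarColorable (Cycle N) k t
realiseOn (_ , refl , W) = realise W

widenOn : ∀ {N k k' t} → k ≤ k' → FamilyOn N k t → FamilyOn N k' t
widenOn k≤k' (m , eq , W) = m , eq , widen k≤k' W

juxtaposeOn : ∀ {N k₁ k₂ t₁ t₂} → FamilyOn N k₁ t₁ → FamilyOn N k₂ t₂ → FamilyOn N (k₁ + k₂) (t₁ + t₂)
juxtaposeOn (m , refl , A) (_ , refl , B) = m , refl , juxtapose A B

module Modular (K : ℕ) .{{_ : NonZero K}} where

  residueMoves : ∀ y d → y < K → d < K → (y + d) % K ≡ y → d ≡ 0
  residueMoves y d y< d< eq with y + d <? K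
  ... | yes y+d< = +-cancelˡ-≡ y d 0 (trans (trans (sym (m<n⇒m%n≡m y+d<)) eq) (sym (+-identityʳ y)))
  ... | no y+d≮ = ⊥-elim (<-irrefl d≡K d<)
    where
    K≤y+d : K ≤ y + d
    K≤y+d = ≮⇒≥ y+d≮
    reduced : y + d ∸ K < K
    reduced = subst (y + d ∸ K <_) (m+n∸n≡m K K) (∸-monoˡ-< (+-mono-< y< d<) K≤y+d)
    wrapped : y + d ∸ K ≡ y
    wrapped = trans (sym (m<n⇒m%n≡m reduced)) (trans (m≤n⇒[n∸m]%m≡n%m K≤y+d) eq)
    d≡K : d ≡ K
    d≡K = +-cancelˡ-≡ y d K (trans (sym (m∸n+n≡m K≤y+d)) (cong (_+ K) wrapped))

  addingMoves : ∀ x d → d < K → (x + d) % K ≡ x % K → d ≡ 0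
  addingMoves x d d< eq = residueMoves (x % K) d (m%n<n x K) d< (begin
    (x % K + d) % K      ≡⟨ cong (λ u → (x % K + u) % K) (sym (m<n⇒m%n≡m d<)) ⟩
    (x % K + d % K) % K  ≡⟨ sym (%-distribˡ-+ x d K) ⟩
    (x + d) % K          ≡⟨ eq ⟩
    x % K                ∎)
    where open ≡-Reasoning

  noGap : ∀ c {a b} → a ≤ b → b < K → (b + c) % K ≡ (a + c) % K → b ≡ a
  noGap c {a} {b} a≤b b< eq = begin
    b            ≡⟨ sym (m+[n∸m]≡n a≤b) ⟩
    a + (b ∸ a)  ≡⟨ cong (a +_) (addingMoves (a + c) (b ∸ a) (≤-<-trans (m∸n≤m b a) b<)
                                  (trans (cong (_% K) split) eq)) ⟩
    a + 0        ≡⟨ +-identityʳ a ⟩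
    a            ∎
    where
    open ≡-Reasoning
    split : a + c + (b ∸ a) ≡ b + c
    split = begin
      a + c + (b ∸ a)    ≡⟨ +-assoc a c (b ∸ a) ⟩
      a + (c + (b ∸ a))  ≡⟨ cong (a +_) (+-comm c (b ∸ a)) ⟩
      a + (b ∸ a + c)    ≡⟨ sym (+-assoc a (b ∸ a) c) ⟩
      a + (b ∸ a) + c    ≡⟨ cong (_+ c) (m+[n∸m]≡n a≤b) ⟩
      b + c              ∎

  cancelʳ : ∀ c {a b} → a < K → b < K → (a + c) % K ≡ (b + c) % K → a ≡ b
  cancelʳ c {a} {b} a< b< eq with ≤-total a b
  ... | inj₁ a≤b = sym (noGap c a≤b b< (sym eq))
  ... | inj₂ b≤a = noGap c b≤a a< eq

  cancelˡ : ∀ c {a b} → a < K → b < K → (c + a) % K ≡ (c + b) % K → a ≡ b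
  cancelˡ c {a} {b} a< b< eq =
    cancelʳ c a< b< (trans (cong (_% K) (+-comm a c)) (trans eq (cong (_% K) (+-comm c b))))

Succ : ℕ → ℕ → ℕ → Set
Succ K x y = suc x ≡ y ⊎ (suc x ≡ K × y ≡ 0)

Adjacent : ℕ → ℕ → ℕ → Set
Adjacent K x y = Succ K x y ⊎ Succ K y x

Adjacent-sym : ∀ {K x y} → Adjacent K x y → Adjacent K y x
Adjacent-sym (inj₁ s) = inj₂ s
Adjacent-sym (inj₂ s) = inj₁ s

-- A shift never meets a different shift of
-- the same letter, nor any shift of a neighbouring letter (the difference of
-- the shift amounts would be odd); this is exactly what compatibility needs.
module Shifts (K : ℕ) .{{_ : NonZero K}} where
  open Modular K

  shift : ℕ → ℕ → ℕ
  shift i x = (2 * i + x) % K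

  record Fits (i : ℕ) : Set where
    constructor fits
    field odd< : suc (2 * i) < K

  even< : ∀ {i} → Fits i → 2 * i < K
  even< (fits odd<) = <-trans (n<1+n _) odd<

  shiftInjective : ∀ i {a b} → a < K → b < K → shift i a ≡ shift i b → a ≡ b
  shiftInjective i = cancelˡ (2 * i)

  shiftSame : ∀ {i j} x → 2 * i < K → 2 * j < K → i ≢ j → shift i x ≢ shift j x
  shiftSame x 2i< 2j< i≢j eq = i≢j (*-cancelˡ-≡ _ _ 2 (cancelʳ x 2i< 2j< eq))

  shiftSucc : ∀ j {x y} → Succ K x y → shift j y ≡ (suc (2 * j) + x) % K
  shiftSucc j {x} (inj₁ refl) = cong (_% K) (+-suc (2 * j) x)
  shiftSucc j {x} (inj₂ (1+x≡K , refl)) = begin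
    (2 * j + 0) % K          ≡⟨ sym ([m+n]%n≡m%n (2 * j + 0) K) ⟩
    (2 * j + 0 + K) % K      ≡⟨ cong (λ u → (2 * j + 0 + u) % K) (sym 1+x≡K) ⟩
    (2 * j + 0 + suc x) % K  ≡⟨ cong (λ u → (u + suc x) % K) (+-identityʳ (2 * j)) ⟩
    (2 * j + suc x) % K      ≡⟨ cong (_% K) (+-suc (2 * j) x) ⟩
    (suc (2 * j) + x) % K    ∎
    where open ≡-Reasoning

  shiftSuccDistinct : ∀ {i j x y} → 2 * i < K → Fits j → Succ K x y → shift i x ≢ shift j y
  shiftSuccDistinct {i} {j} {x} 2i< (fits odd<) s eq =
    even≢odd i j (cancelʳ x 2i< odd< (trans eq (shiftSucc j s)))

  shiftAdjacentDistinct : ∀ {i j x y} → Fits i → Fits j → Adjacent K x y → shift i x ≢ shift j y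
  shiftAdjacentDistinct {i} {j} i-fits j-fits (inj₁ s) = shiftSuccDistinct {i} (even< i-fits) j-fits s
  shiftAdjacentDistinct {i} {j} i-fits j-fits (inj₂ s) eq = shiftSuccDistinct {j} (even< j-fits) i-fits s (sym eq)

  disjointShifts : ∀ {i j x y} → Fits i → Fits j → i ≢ j → Adjacent K x y →
                   (shift i x ≢ shift j x) × (shift i x ≢ shift j y) × (shift i y ≢ shift j x) × (shift i y ≢ shift j y)
  disjointShifts {i} {j} i-fits j-fits i≢j xy =
    shiftSame {i} {j} _ (even< i-fits) (even< j-fits) i≢j , shiftAdjacentDistinct i-fits j-fits xy ,
    shiftAdjacentDistinct i-fits j-fits (Adjacent-sym xy) , shiftSame {i} {j} _ (even< i-fits) (even< j-fits) i≢j

  shiftStar : ∀ {m g} i → (∀ e → g e < K) → StarWord m g → StarWord m (λ e → shift i (g e))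
  shiftStar i g< = renameStar (shift i) (λ a b → shiftInjective i (g< a) (g< b))

  shiftedFamily : ∀ r → 2 * r ≤ K → ∀ m (g : ℕ → ℕ) → (∀ e → g e < K) → StarWord m g →
                  (∀ e → suc e < 3 + m → Adjacent K (g e) (g (suc e))) → Adjacent K (g (2 + m)) (g 0) →
                  WordFamily m K r
  shiftedFamily r 2r≤K m g g< W along around = record
    { word       = λ i e → shift i (g e)
    ; bounded    = λ i e _ _ → m%n<n _ K
    ; star       = λ i _ → shiftStar i g< W
    ; compatible = λ i j i< j< i≢j → record
        { disjointAlong  = λ e e< → disjointShifts (below i<) (below j<) i≢j (along e e<)
        ; disjointAround = disjointShifts (below i<) (below j<) i≢j around } }
    where
    below : ∀ {i} → i < r → Fits i
    below {i} i< = fits (≤-trans (≤-reflexive (sym (*-suc 2 i))) (≤-trans (*-monoʳ-≤ 2 i<) 2r≤K))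

UnitStep : ℕ → ℕ → Set
UnitStep x y = suc x ≡ y ⊎ suc y ≡ x

UnitStep⇒Adjacent : ∀ {K x y} → UnitStep x y → Adjacent K x y
UnitStep⇒Adjacent (inj₁ p) = inj₁ (inj₁ p)
UnitStep⇒Adjacent (inj₂ p) = inj₂ (inj₁ p)

UnitStep⇒≢ : ∀ {x y} → UnitStep x y → x ≢ y
UnitStep⇒≢ (inj₁ p) refl = <-irrefl (sym p) (n<1+n _)
UnitStep⇒≢ (inj₂ p) refl = <-irrefl (sym p) (n<1+n _)

record Zigzag (h : ℕ → ℕ) : Set where
  field
    steps : ∀ t → UnitStep (h t) (h (suc t))
    noAlt : ∀ t → NoAlternation (h t) (h (1 + t)) (h (2 + t)) (h (3 + t))
    small : ∀ t → h t ≤ 3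

zig : ℕ → ℕ
zig 0 = 0
zig 1 = 1
zig 2 = 2
zig 3 = 1
zig (suc (suc (suc (suc t)))) = zig t

zig-periodic : ∀ q c → zig (c + q * 4) ≡ zig c
zig-periodic zero c = cong zig (+-identityʳ c)
zig-periodic (suc q) c = trans (cong zig (+-comm c (4 + q * 4)))
                               (trans (cong zig (+-comm (q * 4) c)) (zig-periodic q c))

zig-zigzag : Zigzag zig
zig-zigzag = record { steps = steps ; noAlt = noAlt ; small = small }
  where
  steps : ∀ t → UnitStep (zig t) (zig (suc t))
  steps 0 = inj₁ refl
  steps 1 = inj₁ refl
  steps 2 = inj₂ refl
  steps 3 = inj₂ refl
  steps (suc (suc (suc (suc t)))) = steps t
  noAlt : ∀ t → NoAlternation (zig t) (zig (1 + t)) (zig (2 + t)) (zig (3 + t))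
  noAlt 0 = λ ()
  noAlt 1 = λ _ ()
  noAlt 2 = λ ()
  noAlt 3 = λ _ ()
  noAlt (suc (suc (suc (suc t)))) = noAlt t
  small : ∀ t → zig t ≤ 3
  small 0 = z≤n
  small 1 = s≤s z≤n
  small 2 = s≤s (s≤s z≤n)
  small 3 = s≤s z≤n
  small (suc (suc (suc (suc t)))) = small t

zigLong : ℕ → ℕ
zigLong 0 = 0
zigLong 1 = 1
zigLong 2 = 2
zigLong 3 = 3
zigLong (suc (suc (suc (suc t)))) = zig (2 + t)

zigLong-zigzag : Zigzag zigLong
zigLong-zigzag = record { steps = steps ; noAlt = noAlt ; small = small }
  where
  open Zigzag zig-zigzag renaming (steps to zigSteps; noAlt to zigNoAlt; small to zigSmall)
  steps : ∀ t → UnitStep (zigLong t) (zigLong (suc t))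
  steps 0 = inj₁ refl
  steps 1 = inj₁ refl
  steps 2 = inj₁ refl
  steps 3 = inj₂ refl
  steps (suc (suc (suc (suc t)))) = zigSteps (2 + t)
  noAlt : ∀ t → NoAlternation (zigLong t) (zigLong (1 + t)) (zigLong (2 + t)) (zigLong (3 + t))
  noAlt 0 = λ ()
  noAlt 1 = λ ()
  noAlt 2 = λ _ ()
  noAlt 3 = λ ()
  noAlt (suc (suc (suc (suc t)))) = zigNoAlt (2 + t)
  small : ∀ t → zigLong t ≤ 3
  small 0 = z≤n
  small 1 = s≤s z≤n
  small 2 = s≤s (s≤s z≤n)
  small 3 = ≤-refl
  small (suc (suc (suc (suc t)))) = zigSmall (2 + t)

-- A zigzag starting 0 1 2 whose letters at positions 1+m, 2+m are 2, 1 is a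
-- star word on C_(3+m): the wrap-around 1 → 0 is again a unit step.
closedZigzag : ∀ m {h} → Zigzag h → h 0 ≡ 0 → h 2 ≡ 2 → h (1 + m) ≡ 2 → h (2 + m) ≡ 1 → StarWord m h
closedZigzag m Z h0 h2 end₁ end₂ = record
  { properAlong  = λ e _ → UnitStep⇒≢ (steps e)
  ; properAround = λ eq → 1+n≢0 (trans (sym end₂) (trans eq h0))
  ; starAlong    = λ e _ → noAlt e
  ; starAround₁  = λ _ eq → 1+n≢0 (trans (sym end₁) (trans eq h0))
  ; starAround₂  = λ eq _ → 1+n≢0 (trans (sym end₁) (trans eq h0))
  ; starAround₃  = λ _ eq → 1+n≢0 (sym (trans (sym h0) (trans eq h2))) }
  where open Zigzag Z

evenFamily : ∀ r m {h} → 2 ≤ r → Zigzag h → h 0 ≡ 0 → h 2 ≡ 2 → h (1 + m) ≡ 2 → h (2 + m) ≡ 1 →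
             WordFamily m (2 * r) r
evenFamily .(suc (suc r')) m {h} (s≤s (s≤s {n = r'} _)) Z h0 h2 end₁ end₂ =
  shiftedFamily (suc (suc r')) ≤-refl m h (λ e → ≤-<-trans (small e) 3<2r) (closedZigzag m Z h0 h2 end₁ end₂)
    (λ e _ → UnitStep⇒Adjacent (steps e)) (UnitStep⇒Adjacent (inj₂ (trans (cong suc h0) (sym end₂))))
  where
  open Zigzag Z
  open Shifts (2 * suc (suc r'))
  3<2r : 3 < 2 * suc (suc r')
  3<2r = *-monoʳ-≤ 2 (s≤s (s≤s z≤n))

data EvenShape : ℕ → Set where
  fourMod : ∀ q → EvenShape (4 + q * 4)
  sixMod  : ∀ q → EvenShape (6 + q * 4)

plusFour : ∀ {N} → EvenShape N → EvenShape (4 + N)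
plusFour (fourMod q) = fourMod (suc q)
plusFour (sixMod q) = sixMod (suc q)

evenShape : ∀ h → 2 ≤ h → EvenShape (h * 2)
evenShape 1 (s≤s ())
evenShape 2 _ = fourMod 0
evenShape 3 _ = sixMod 0
evenShape (suc (suc (suc (suc h)))) _ = plusFour (evenShape (suc (suc h)) (s≤s (s≤s z≤n)))

evenForm : ∀ n → n % 2 ≡ 0 → n ≡ n / 2 * 2
evenForm n even = trans (m≡m%n+[m/n]*n n 2) (cong (_+ n / 2 * 2) even)

oddForm : ∀ n → n % 2 ≡ 1 → n ≡ 1 + n / 2 * 2
oddForm n odd = trans (m≡m%n+[m/n]*n n 2) (cong (_+ n / 2 * 2) odd)

evenCycles : ∀ n r → 2 ≤ r → n % 2 ≡ 0 → 4 ≤ n → StarColorable (Cycle n) (2 * r) r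
evenCycles n r 2≤r even 4≤n =
  subst (λ N → StarColorable (Cycle N) (2 * r) r) (sym n≡h*2) (fromShape (evenShape (n / 2) 2≤h))
  where
  n≡h*2 : n ≡ n / 2 * 2
  n≡h*2 = evenForm n even
  2≤h : 2 ≤ n / 2
  2≤h = *-cancelʳ-≤ 2 (n / 2) 2 (subst (4 ≤_) n≡h*2 4≤n)
  fromShape : ∀ {N} → EvenShape N → StarColorable (Cycle N) (2 * r) r
  fromShape (fourMod q) =
    realise (evenFamily r (1 + q * 4) 2≤r zig-zigzag refl refl (zig-periodic q 2) (zig-periodic q 3))
  fromShape (sixMod q) =
    realise (evenFamily r (3 + q * 4) 2≤r zigLong-zigzag refl refl (zig-periodic q 2) (zig-periodic q 3))

reflectZigzag : ∀ {h} → Zigzag h → Zigzag (λ t → 3 ∸ h t)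
reflectZigzag {h} Z = record
  { steps = λ t → reflectStep (small t) (small (suc t)) (steps t)
  ; noAlt = λ t p q → noAlt t (∸-cancelˡ-≡ (small t) (small (2 + t)) p)
                              (∸-cancelˡ-≡ (small (1 + t)) (small (3 + t)) q)
  ; small = λ t → m∸n≤m 3 (h t) }
  where
  open Zigzag Z
  reflectStep : ∀ {x y} → x ≤ 3 → y ≤ 3 → UnitStep x y → UnitStep (3 ∸ x) (3 ∸ y)
  reflectStep _ y≤3 (inj₁ refl) = inj₂ (sym (+-∸-assoc 1 y≤3))
  reflectStep x≤3 _ (inj₂ refl) = inj₁ (sym (+-∸-assoc 1 x≤3))

zag zagLong : ℕ → ℕ
zag t = 3 ∸ zig t
zagLong t = 3 ∸ zigLong t

zag-zigzag : Zigzag zag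
zag-zigzag = reflectZigzag zig-zigzag

zagLong-zigzag : Zigzag zagLong
zagLong-zigzag = reflectZigzag zigLong-zigzag

ramp : ℕ → (ℕ → ℕ) → ℕ → ℕ
ramp R tail e with e ≤? R
... | yes _ = e
... | no _ = tail (e ∸ R)

ramp-up : ∀ {R tail e} → e ≤ R → ramp R tail e ≡ e
ramp-up {R} {tail} {e} e≤R with e ≤? R
... | yes _ = refl
... | no e≰R = ⊥-elim (e≰R e≤R)

ramp-tail : ∀ {R tail} t → ramp R tail (suc t + R) ≡ tail (suc t)
ramp-tail {R} {tail} t with suc t + R ≤? R
... | yes past = ⊥-elim (<⇒≱ (s≤s (m≤n+m R t)) past)
... | no _ = cong tail (m+n∸n≡m (suc t) R)

ramp-climb : ∀ {R tail e} → suc e ≤ R → UnitStep (ramp R tail e) (ramp R tail (suc e))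
ramp-climb e<R = inj₁ (trans (cong suc (ramp-up (<⇒≤ e<R))) (sym (ramp-up e<R)))

n≢2+n : ∀ n → n ≢ 2 + n
n≢2+n n eq = <-irrefl eq (<-trans (n<1+n n) (n<1+n (suc n)))

ramp-noReturn : ∀ {R tail e} → 2 + e ≤ R → ramp R tail e ≢ ramp R tail (2 + e)
ramp-noReturn {e = e} 2+e≤R eq =
  n≢2+n e (trans (sym (ramp-up (≤-trans (m≤n+m e 2) 2+e≤R))) (trans eq (ramp-up 2+e≤R)))

data RampPosition (S : ℕ) : ℕ → Set where
  climbing : ∀ {e} → e ≤ S → RampPosition S e
  nearTop₁ : RampPosition S (1 + S)
  nearTop₂ : RampPosition S (2 + S)
  inTail   : ∀ t → RampPosition S (t + (3 + S))

rampPosition : ∀ S e → RampPosition S e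
rampPosition S e with e ≤? S
... | yes e≤S = climbing e≤S
... | no e≰S with m≤n⇒∃[o]m+o≡n (≰⇒> e≰S)
... | 0 , refl = subst (RampPosition S) (sym (+-identityʳ (suc S))) nearTop₁
... | 1 , refl = subst (RampPosition S) (cong suc (+-comm 1 S)) nearTop₂
... | suc (suc t) , refl = subst (RampPosition S) t+R≡e (inTail t)
  where
  t+R≡e : t + (3 + S) ≡ suc S + suc (suc t)
  t+R≡e = trans (+-comm t (3 + S)) (sym (cong suc (trans (+-suc S (suc t)) (cong suc (+-suc S t)))))

-- The base word for odd cycles on K = 4 + S colours: climb 0 1 … R with
-- R = 3 + S, then zigzag below the top as S + c where c = 3 2 1 ….  It moves
-- by unit steps, and a copy ending …, R-1, R closes up around ℤ/K by R → 0.
module OddWord (S : ℕ) {c : ℕ → ℕ} (Z : Zigzag c) (c0 : c 0 ≡ 3) (c1 : c 1 ≡ 2) (c2 : c 2 ≡ 1) where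
  open Zigzag Z

  nearTop : ℕ → ℕ
  nearTop t = c t + S

  word : ℕ → ℕ
  word = ramp (3 + S) nearTop

  word-tail : ∀ t → word (t + (3 + S)) ≡ c t + S
  word-tail zero = trans (ramp-up ≤-refl) (cong (_+ S) (sym c0))
  word-tail (suc t) = ramp-tail {3 + S} {nearTop} t

  word-up : ∀ {e} → e ≤ 3 + S → word e ≡ e
  word-up = ramp-up {3 + S} {nearTop}

  climb : ∀ {e} → suc e ≤ 3 + S → UnitStep (word e) (word (suc e))
  climb = ramp-climb {3 + S} {nearTop}

  noReturn : ∀ {e} → 2 + e ≤ 3 + S → word e ≢ word (2 + e)
  noReturn = ramp-noReturn {3 + S} {nearTop}

  onRamp : ∀ {e} → e ≤ 3 + S → word e ≤ 3 + S
  onRamp e≤R = ≤-trans (≤-reflexive (word-up e≤R)) e≤R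

  word< : ∀ e → word e < 4 + S
  word< e with rampPosition S e
  ... | climbing e≤S = s≤s (onRamp (≤-trans e≤S (m≤n+m S 3)))
  ... | nearTop₁ = s≤s (onRamp (≤-trans (n≤1+n _) (n≤1+n _)))
  ... | nearTop₂ = s≤s (onRamp (n≤1+n _))
  ... | inTail t = s≤s (≤-trans (≤-reflexive (word-tail t)) (+-monoˡ-≤ S (small t)))

  tailEq : ∀ {a b} → word (a + (3 + S)) ≡ word (b + (3 + S)) → c a ≡ c b
  tailEq {a} {b} eq = +-cancelʳ-≡ S (c a) (c b) (trans (sym (word-tail a)) (trans eq (word-tail b)))

  word-steps : ∀ e → UnitStep (word e) (word (suc e))
  word-steps e with rampPosition S e
  ... | climbing e≤S = climb (≤-trans (s≤s e≤S) (m≤n+m (suc S) 2))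
  ... | nearTop₁ = climb (n≤1+n _)
  ... | nearTop₂ = climb ≤-refl
  ... | inTail t with steps t
  ...   | inj₁ up = inj₁ (trans (cong suc (word-tail t)) (trans (cong (_+ S) up) (sym (word-tail (suc t)))))
  ...   | inj₂ down = inj₂ (trans (cong suc (word-tail (suc t))) (trans (cong (_+ S) down) (sym (word-tail t))))

  word-noAlt : ∀ e → NoAlternation (word e) (word (1 + e)) (word (2 + e)) (word (3 + e))
  word-noAlt e with rampPosition S e
  ... | climbing e≤S = λ p _ → noReturn (≤-trans (s≤s (s≤s e≤S)) (n≤1+n _)) p
  ... | nearTop₁ = λ p _ → noReturn ≤-refl p
  ... | nearTop₂ = λ _ q →
    n≢2+n (1 + S) (sym (trans (sym (word-up ≤-refl)) (trans q (trans (word-tail 2) (cong (_+ S) c2)))))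
  ... | inTail t = λ p q → noAlt t (tailEq {t} {2 + t} p) (tailEq {1 + t} {3 + t} q)

  closedWord : ∀ m → word (1 + m) ≡ 2 + S → word (2 + m) ≡ 3 + S → StarWord m word
  closedWord m end₁ end₂ = record
    { properAlong  = λ e _ → UnitStep⇒≢ (word-steps e)
    ; properAround = λ p → 1+n≢0 (trans (sym end₂) (trans p word0))
    ; starAlong    = λ e _ → word-noAlt e
    ; starAround₁  = λ _ q → 1+n≢0 (trans (sym end₁) (trans q word0))
    ; starAround₂  = λ p _ → 1+n≢0 (trans (sym end₁) (trans p word0))
    ; starAround₃  = λ p _ → 1+n≢0 (suc-injective (trans (sym end₂) (trans p (word-up (s≤s z≤n))))) }
    where
    word0 : word 0 ≡ 0
    word0 = word-up z≤n

  oddFamily : ∀ r m → 2 * r ≤ 4 + S → word (1 + m) ≡ 2 + S → word (2 + m) ≡ 3 + S → WordFamily m (4 + S) r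
  oddFamily r m 2r≤K end₁ end₂ =
    shiftedFamily r 2r≤K m word word< (closedWord m end₁ end₂) (λ e _ → UnitStep⇒Adjacent (word-steps e))
                  (inj₁ (inj₂ (cong suc end₂ , word-up z≤n)))
    where open Shifts (4 + S)

  atTop : ∀ r → 2 * r ≤ 4 + S → WordFamily (1 + S) (4 + S) r
  atTop r 2r≤K = oddFamily r (1 + S) 2r≤K (word-up (n≤1+n _)) (word-up ≤-refl)

  inTailEnding : ∀ r t → 2 * r ≤ 4 + S → c t ≡ 2 → c (suc t) ≡ 3 → WordFamily (t + (2 + S)) (4 + S) r
  inTailEnding r t 2r≤K ct csuct = oddFamily r (t + (2 + S)) 2r≤K
    (trans (cong word (sym (+-suc t (2 + S)))) (trans (word-tail t) (cong (_+ S) ct)))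
    (trans (cong (λ e → word (suc e)) (sym (+-suc t (2 + S)))) (trans (word-tail (suc t)) (cong (_+ S) csuct)))

-- Here the words depend on
-- the layer: layer i reads the ramp 0 1 … R followed by 0, wᵢ, shifted by 2i,
-- where wᵢ = 3 except in the top layer i = r - 1, where wᵢ = 2 (so that its
-- last colour 2r does not wrap to 0).  The last letters are themselves shifts,
-- of 1 by i + 1 or of 0 by r, so the layers stay compatible.
module TwoBeyond (r' : ℕ) where
  r S R K : ℕ
  r = 2 + r'
  S = 1 + 2 * r'
  R = 3 + S
  K = 4 + S

  open Shifts K

  2r≡R : 2 * r ≡ R
  2r≡R = trans (*-suc 2 (suc r')) (cong (2 +_) (*-suc 2 r'))

  2r<K : 2 * r < K
  2r<K = s≤s (≤-reflexive 2r≡R)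

  fitsR : ∀ {i} → i < r → Fits i
  fitsR i< = fits (s≤s (≤-trans (*-monoʳ-< 2 i<) (≤-reflexive 2r≡R)))

  ending : ℕ → ℕ → ℕ
  ending w 1 = 0
  ending w _ = w

  base : ℕ → ℕ → ℕ
  base w = ramp R (ending w)

  base-up : ∀ w e → e ≤ R → base w e ≡ e
  base-up w e = ramp-up {R} {ending w} {e}

  base₁ : ∀ w → base w (1 + R) ≡ 0
  base₁ w = ramp-tail {R} {ending w} 0

  base₂ : ∀ w → base w (2 + R) ≡ w
  base₂ w = ramp-tail {R} {ending w} 1

  data Edge : ℕ → Set where
    rising  : ∀ {e} → suc e ≤ R → Edge e
    falling : Edge R
    last    : Edge (1 + R)

  edge : ∀ e → suc e < 3 + R → Edge e
  edge e e< with rampPosition S e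
  ... | climbing e≤S = rising (≤-trans (s≤s e≤S) (m≤n+m (suc S) 2))
  ... | nearTop₁ = rising (n≤1+n _)
  ... | nearTop₂ = rising ≤-refl
  ... | inTail 0 = falling
  ... | inTail 1 = last
  ... | inTail (suc (suc t)) = ⊥-elim (<⇒≱ e< (s≤s (s≤s (s≤s (m≤n+m R t)))))

  ending≤ : ∀ {w} x → w ≤ 3 → ending w x ≤ 3
  ending≤ 1 _ = z≤n
  ending≤ 0 w≤3 = w≤3
  ending≤ (suc (suc _)) w≤3 = w≤3

  base< : ∀ {w} → w ≤ 3 → ∀ e → base w e < K
  base< w≤3 e with e ≤? R
  ... | yes e≤R = s≤s e≤R
  ... | no _ = ≤-trans (s≤s (ending≤ (e ∸ R) w≤3)) (s≤s (s≤s (s≤s (s≤s z≤n))))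

  baseStar : ∀ w → 2 ≤ w → w < R → StarWord R (base w)
  baseStar w 2≤w w<R = record
    { properAlong  = properAlong
    ; properAround = λ p → w≢0 (trans (sym (base₂ w)) (trans p (base-up w 0 z≤n)))
    ; starAlong    = starAlong
    ; starAround₁  = λ p _ → <-irrefl (sym (trans (sym (base-up w R ≤-refl)) (trans p (base₂ w)))) w<R
    ; starAround₂  = λ _ q → w≢1 (trans (sym (base₂ w)) (trans q (base-up w 1 (s≤s z≤n))))
    ; starAround₃  = λ p _ → w≢1 (trans (sym (base₂ w)) (trans p (base-up w 1 (s≤s z≤n)))) }
    where
    w≢0 : w ≢ 0
    w≢0 w≡0 = <⇒≱ (s≤s z≤n) (subst (2 ≤_) w≡0 2≤w)
    w≢1 : w ≢ 1
    w≢1 w≡1 = <⇒≱ ≤-refl (subst (2 ≤_) w≡1 2≤w)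

    properAlong : ∀ e → suc e < 3 + R → base w e ≢ base w (suc e)
    properAlong e e< with edge e e<
    ... | rising e<R = UnitStep⇒≢ (ramp-climb {R} {ending w} e<R)
    ... | falling = λ p → 1+n≢0 (trans (sym (base-up w R ≤-refl)) (trans p (base₁ w)))
    ... | last = λ p → w≢0 (sym (trans (sym (base₁ w)) (trans p (base₂ w))))

    starAlong : ∀ e → 3 + e < 3 + R → NoAlternation (base w e) (base w (1 + e)) (base w (2 + e)) (base w (3 + e))
    starAlong e 3+e< with rampPosition S e
    ... | climbing e≤S = λ p _ → ramp-noReturn {R} {ending w} (≤-trans (s≤s (s≤s e≤S)) (n≤1+n _)) p
    ... | nearTop₁ = λ p _ → ramp-noReturn {R} {ending w} ≤-refl p
    ... | nearTop₂ = λ p _ → 1+n≢0 (trans (sym (base-up w (2 + S) (n≤1+n _))) (trans p (base₁ w)))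
    ... | inTail t = ⊥-elim (<⇒≱ 3+e< (+-monoʳ-≤ 3 (m≤n+m R t)))

  lastLetter : ℕ → ℕ
  lastLetter i with suc i ≟ r
  ... | yes _ = 2
  ... | no _ = 3

  lastLetter-range : ∀ i → 2 ≤ lastLetter i × lastLetter i ≤ 3
  lastLetter-range i with suc i ≟ r
  ... | yes _ = ≤-refl , n≤1+n 2
  ... | no _ = n≤1+n 2 , ≤-refl

  layer : ℕ → ℕ → ℕ
  layer i e = shift i (base (lastLetter i) e)

  finalShift : ∀ i → i < r → (suc i ≡ r × shift i (lastLetter i) ≡ shift r 0)
                             ⊎ (suc i < r × shift i (lastLetter i) ≡ shift (suc i) 1)
  finalShift i i< with suc i ≟ r
  ... | yes top = inj₁ (top , cong (_% K) (begin
    2 * i + 2     ≡⟨ +-comm (2 * i) 2 ⟩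
    2 + 2 * i     ≡⟨ sym (*-suc 2 i) ⟩
    2 * suc i     ≡⟨ cong (2 *_) top ⟩
    2 * r         ≡⟨ sym (+-identityʳ (2 * r)) ⟩
    2 * r + 0     ∎))
    where open ≡-Reasoning
  ... | no ¬top = inj₂ (≤∧≢⇒< i< ¬top , cong (_% K) (begin
    2 * i + 3          ≡⟨ +-comm (2 * i) 3 ⟩
    3 + 2 * i          ≡⟨ cong suc (sym (*-suc 2 i)) ⟩
    1 + 2 * suc i      ≡⟨ +-comm 1 (2 * suc i) ⟩
    2 * suc i + 1      ∎))
    where open ≡-Reasoning

  2i<K : ∀ {i} → i < r → 2 * i < K
  2i<K i< = <-trans (*-monoʳ-< 2 i<) 2r<K

  firstLast : ∀ {i j} → i < r → j < r → shift i 0 ≢ shift j (lastLetter j)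
  firstLast {i} {j} i< j< h with finalShift j j<
  ... | inj₁ (_ , eq) = shiftSame {i} {r} 0 (2i<K i<) 2r<K (λ i≡r → <-irrefl i≡r i<) (trans h eq)
  ... | inj₂ (j+1< , eq) = shiftSuccDistinct {i} (2i<K i<) (fitsR j+1<) (inj₁ refl) (trans h eq)

  lastLast : ∀ {i j} → i < r → j < r → i ≢ j → shift i (lastLetter i) ≢ shift j (lastLetter j)
  lastLast {i} {j} i< j< i≢j h with finalShift i i< | finalShift j j<
  ... | inj₁ (top , _) | inj₁ (top' , _) = i≢j (suc-injective (trans top (sym top')))
  ... | inj₁ (_ , ei) | inj₂ (j+1< , ej) =
    shiftSuccDistinct {r} 2r<K (fitsR j+1<) (inj₁ refl) (trans (sym ei) (trans h ej))
  ... | inj₂ (i+1< , ei) | inj₁ (_ , ej) =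
    shiftSuccDistinct {r} 2r<K (fitsR i+1<) (inj₁ refl) (trans (sym ej) (trans (sym h) ei))
  ... | inj₂ (i+1< , ei) | inj₂ (j+1< , ej) =
    shiftSame {suc i} {suc j} 1 (2i<K i+1<) (2i<K j+1<) (λ eq → i≢j (suc-injective eq)) (trans (sym ei) (trans h ej))

  viaLetters : ∀ {i j a b x y x' y'} →
               base (lastLetter i) a ≡ x → base (lastLetter i) b ≡ y →
               base (lastLetter j) a ≡ x' → base (lastLetter j) b ≡ y' →
               (shift i x ≢ shift j x') × (shift i x ≢ shift j y') × (shift i y ≢ shift j x') × (shift i y ≢ shift j y') →
               DisjointAt (layer i) (layer j) a b
  viaLetters refl refl refl refl d = d

  compatibleLayers : ∀ i j → i < r → j < r → i ≢ j → CompatibleWords R (layer i) (layer j)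
  compatibleLayers i j i< j< i≢j = record { disjointAlong = along ; disjointAround = around }
    where
    wᵢ wⱼ : ℕ
    wᵢ = lastLetter i
    wⱼ = lastLetter j

    along : ∀ e → suc e < 3 + R → DisjointAt (layer i) (layer j) e (suc e)
    along e e< with edge e e<
    ... | rising e<R = viaLetters {i} {j} {e} {suc e} (base-up wᵢ e (<⇒≤ e<R)) (base-up wᵢ (suc e) e<R)
                                                      (base-up wⱼ e (<⇒≤ e<R)) (base-up wⱼ (suc e) e<R)
                         (disjointShifts (fitsR i<) (fitsR j<) i≢j (inj₁ (inj₁ refl)))
    ... | falling = viaLetters {i} {j} {R} {1 + R} (base-up wᵢ R ≤-refl) (base₁ wᵢ) (base-up wⱼ R ≤-refl) (base₁ wⱼ)
                      (disjointShifts (fitsR i<) (fitsR j<) i≢j (inj₁ (inj₂ (refl , refl))))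
    ... | last = viaLetters {i} {j} {1 + R} {2 + R} (base₁ wᵢ) (base₂ wᵢ) (base₁ wⱼ) (base₂ wⱼ)
                   (shiftSame {i} {j} 0 (2i<K i<) (2i<K j<) i≢j , firstLast i< j< ,
                    (λ h → firstLast j< i< (sym h)) , lastLast i< j< i≢j)

    around : DisjointAt (layer i) (layer j) (2 + R) 0
    around = viaLetters {i} {j} {2 + R} {0} (base₂ wᵢ) (base-up wᵢ 0 z≤n) (base₂ wⱼ) (base-up wⱼ 0 z≤n)
               (lastLast i< j< i≢j , (λ h → firstLast j< i< (sym h)) , firstLast i< j< ,
                shiftSame {i} {j} 0 (2i<K i<) (2i<K j<) i≢j)

  twoBeyond : WordFamily R K r
  twoBeyond = record
    { word       = layer
    ; bounded    = λ i e _ _ → m%n<n (2 * i + base (lastLetter i) e) K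
    ; star       = λ i _ → shiftStar {R} {base (lastLetter i)} i (base< (proj₂ (lastLetter-range i)))
                             (baseStar (lastLetter i) (proj₁ (lastLetter-range i))
                                       (≤-trans (s≤s (proj₂ (lastLetter-range i))) (s≤s (s≤s (s≤s (s≤s z≤n))))))
    ; compatible = compatibleLayers }

-- Lengths K and K + 4 + 4q, K + 6 + 4q
-- come from the odd base word (stopping at the top of the ramp, or in the
-- tail zag resp. zagLong); length K + 2 is the layer-dependent construction.
module OddLengths (r' : ℕ) where
  open TwoBeyond r' using (r; S; R; K; 2r≡R; twoBeyond)

  2r≤K : 2 * r ≤ K
  2r≤K = ≤-trans (≤-reflexive 2r≡R) (n≤1+n R)

  module ZagWord     = OddWord S zag-zigzag refl refl refl
  module ZagLongWord = OddWord S zagLong-zigzag refl refl refl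

  tailLength : ∀ a → 3 + (a + (2 + S)) ≡ K + suc a
  tailLength a = trans (cong (3 +_) (+-comm a (2 + S))) (sym (cong (4 +_) (+-suc S a)))

  fromShape : ∀ {d} → EvenShape d → FamilyOn (K + d) K r
  fromShape (fourMod q) = _ , tailLength (3 + q * 4) ,
    ZagWord.inTailEnding r (3 + q * 4) 2r≤K (cong (3 ∸_) (zig-periodic q 3)) (cong (3 ∸_) (zig-periodic q 0))
  fromShape (sixMod q) = _ , tailLength (5 + q * 4) ,
    ZagLongWord.inTailEnding r (5 + q * 4) 2r≤K (cong (3 ∸_) (zig-periodic q 3)) (cong (3 ∸_) (zig-periodic q 0))

  beyond : ∀ h → FamilyOn (K + h * 2) K r
  beyond 0 = _ , sym (+-identityʳ K) , ZagWord.atTop r 2r≤K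
  beyond 1 = _ , cong (4 +_) (+-comm 2 S) , twoBeyond
  beyond (suc (suc h)) = fromShape (evenShape (suc (suc h)) (s≤s (s≤s z≤n)))

oddFamilies : ∀ n r → 2 ≤ r → n % 2 ≡ 1 → 2 * r + 1 ≤ n → FamilyOn n (2 * r + 1) r
oddFamilies n .(2 + r') (s≤s (s≤s {n = r'} _)) odd 2r+1≤n =
  subst₂ (λ N k → FamilyOn N k r) (sym n≡K+2h) K≡2r+1 (beyond h)
  where
  open TwoBeyond r' using (r; R; K; 2r≡R)
  open OddLengths r' using (beyond)
  r≤n/2 : r ≤ n / 2
  r≤n/2 = *-cancelʳ-≤ r (n / 2) 2
            (≤-pred (≤-trans (≤-reflexive (trans (cong suc (*-comm r 2)) (+-comm 1 (2 * r))))
                             (≤-trans 2r+1≤n (≤-reflexive (oddForm n odd)))))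
  h : ℕ
  h = proj₁ (m≤n⇒∃[o]m+o≡n r≤n/2)
  r+h≡n/2 : r + h ≡ n / 2
  r+h≡n/2 = proj₂ (m≤n⇒∃[o]m+o≡n r≤n/2)
  1+r*2≡K : 1 + r * 2 ≡ K
  1+r*2≡K = cong suc (trans (*-comm r 2) 2r≡R)
  n≡K+2h : n ≡ K + h * 2
  n≡K+2h = begin
    n                    ≡⟨ oddForm n odd ⟩
    1 + n / 2 * 2        ≡⟨ cong (λ x → 1 + x * 2) (sym r+h≡n/2) ⟩
    1 + (r + h) * 2      ≡⟨ cong suc (*-distribʳ-+ 2 r h) ⟩
    1 + r * 2 + h * 2    ≡⟨ cong (_+ h * 2) 1+r*2≡K ⟩
    K + h * 2            ∎
    where open ≡-Reasoning
  K≡2r+1 : K ≡ 2 * r + 1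
  K≡2r+1 = trans (cong suc (sym 2r≡R)) (+-comm 1 (2 * r))

oddCycles : ∀ n r → 2 ≤ r → n % 2 ≡ 1 → 2 * r + 1 ≤ n → StarColorable (Cycle n) (2 * r + 1) r
oddCycles n r 2≤r odd 2r+1≤n = realiseOn (oddFamilies n r 2≤r odd 2r+1≤n)

-- The word conditions are decidable, being bounded quantifications over
-- comparisons of natural numbers; small explicit families can therefore be
-- verified by computation.
∀<? : {P : ℕ → Set} → (∀ e → Dec (P e)) → ∀ v → Dec (∀ e → e < v → P e)
∀<? P? zero = yes (λ _ ())
∀<? {P} P? (suc v) with ∀<? P? v | P? v
... | yes below | yes atV = yes upTo
  where
  upTo : ∀ e → e < suc v → P e
  upTo e e< with m≤n⇒m<n∨m≡n (≤-pred e<)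
  ... | inj₁ e<v = below e e<v
  ... | inj₂ refl = atV
... | no ¬below | _ = no (λ all → ¬below (λ e e<v → all e (m<n⇒m<1+n e<v)))
... | _ | no ¬atV = no (λ all → ¬atV (all v ≤-refl))

∀+<? : {P : ℕ → Set} → (∀ e → Dec (P e)) → ∀ k v → Dec (∀ e → k + e < k + v → P e)
∀+<? P? k v = map′ (λ all e k+e< → all e (+-cancelˡ-< k _ _ k+e<)) (λ all e e< → all e (+-monoʳ-< k e<)) (∀<? P? v)

noAlternation? : ∀ a b c d → Dec (NoAlternation a b c d)
noAlternation? a b c d = (a ≟ c) →-dec ((b ≟ d) →-dec no (λ ()))

disjointAt? : ∀ (f g : ℕ → ℕ) a b → Dec (DisjointAt f g a b)
disjointAt? f g a b = ¬? (f a ≟ g a) ×-dec ¬? (f a ≟ g b) ×-dec ¬? (f b ≟ g a) ×-dec ¬? (f b ≟ g b)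

starWord? : ∀ m f → Dec (StarWord m f)
starWord? m f = map′ toRecord fromRecord
  (∀+<? (λ e → ¬? (f e ≟ f (suc e))) 1 (2 + m) ×-dec ¬? (f (2 + m) ≟ f 0) ×-dec
   ∀+<? (λ e → noAlternation? (f e) (f (1 + e)) (f (2 + e)) (f (3 + e))) 3 m ×-dec
   noAlternation? (f m) (f (1 + m)) (f (2 + m)) (f 0) ×-dec
   noAlternation? (f (1 + m)) (f (2 + m)) (f 0) (f 1) ×-dec
   noAlternation? (f (2 + m)) (f 0) (f 1) (f 2))
  where
  toRecord : _ → StarWord m f
  toRecord (a , b , c , d , e , g) = record
    { properAlong = a ; properAround = b ; starAlong = c ; starAround₁ = d ; starAround₂ = e ; starAround₃ = g }
  fromRecord : StarWord m f → _
  fromRecord W = properAlong , properAround , starAlong , starAround₁ , starAround₂ , starAround₃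
    where open StarWord W

compatibleWords? : ∀ m f g → Dec (CompatibleWords m f g)
compatibleWords? m f g = map′ (λ (a , b) → record { disjointAlong = a ; disjointAround = b })
  (λ C → CompatibleWords.disjointAlong C , CompatibleWords.disjointAround C)
  (∀+<? (λ e → disjointAt? f g e (suc e)) 1 (2 + m) ×-dec disjointAt? f g (2 + m) 0)

five : ℕ → ℕ → ℕ → ℕ → ℕ → ℕ → ℕ
five a _ _ _ _ 0 = a
five _ b _ _ _ 1 = b
five _ _ c _ _ 2 = c
five _ _ _ d _ 3 = d
five _ _ _ _ x _ = x

pentagon : ℕ → ℕ → ℕ
pentagon 0 = five 0 3 0 2 5
pentagon 1 = five 1 4 1 3 6
pentagon _ = five 2 5 6 4 7

pentagonFamily : WordFamily 2 8 3
pentagonFamily = record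
  { word       = pentagon
  ; bounded    = λ i e i< e< →
      toWitness {a? = ∀<? (λ i → ∀<? (λ e → pentagon i e <? 8) 5) 3} tt i i< e e<
  ; star       = toWitness {a? = ∀<? (λ i → starWord? 2 (pentagon i)) 3} tt
  ; compatible = λ i j i< j< → toWitness {a? = ∀<? (λ i → ∀<? (λ j →
      ¬? (i ≟ j) →-dec compatibleWords? 2 (pentagon i) (pentagon j)) 3) 3} tt i i< j j< }

ceilDiv-step : ∀ a b → ceilDiv (a + suc b) (suc b) ≡ suc (ceilDiv a (suc b))
ceilDiv-step a b = begin
  (a + suc b + b) / suc b                ≡⟨ cong (_/ suc b) (swapLast a (suc b) b) ⟩
  (a + b + suc b) / suc b                ≡⟨ m/n≡1+[m∸n]/n (m≤n+m (suc b) (a + b)) ⟩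
  suc ((a + b + suc b ∸ suc b) / suc b)  ≡⟨ cong (λ x → suc (x / suc b)) (m+n∸n≡m (a + b) (suc b)) ⟩
  suc ((a + b) / suc b)                  ∎
  where
  open ≡-Reasoning
  swapLast : ∀ x y z → x + y + z ≡ x + z + y
  swapLast = solve-∀

ceilDiv-pos : ∀ a b → 0 < a → 0 < b → 0 < ceilDiv a b
ceilDiv-pos (suc a) (suc b) _ _ = m≥n⇒m/n>0 (+-monoˡ-≤ b (s≤s z≤n))

-- For r ≤ q,
-- part (ii) already uses 2r + 1 ≤ 2r + C r colours.  Adding q layers of
-- part (ii) on 2q + 1 fresh colours raises 2r + C r by exactly 2q + 1,
-- since C (r + q) = C r + 1.  So all r ≥ 2 follow by induction once the
-- first value above q, r = q + 1, is settled (done separately below).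
module ThirdPart (q₀ : ℕ) where
  q n : ℕ
  q = 2 + q₀
  n = suc (2 * q)

  C : ℕ → ℕ
  C x = ceilDiv (2 * x) (2 * q)

  Fam : ℕ → Set
  Fam r = FamilyOn n (2 * r + C r) r

  n-odd : n % 2 ≡ 1
  n-odd = trans (cong (λ x → suc x % 2) (*-comm 2 q)) ([m+kn]%n≡m%n 1 q 2)

  fromII : ∀ r → 2 ≤ r → r ≤ q → FamilyOn n (2 * r + 1) r
  fromII r 2≤r r≤q = oddFamilies n r 2≤r n-odd (≤-trans (≤-reflexive (+-comm (2 * r) 1)) (s≤s (*-monoʳ-≤ 2 r≤q)))

  C-step : ∀ x → C (x + q) ≡ suc (C x)
  C-step x = trans (cong (λ y → ceilDiv y (2 * q)) (*-distribˡ-+ 2 x q)) (ceilDiv-step (2 * x) _)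

  C-pos : ∀ x → 1 ≤ C (suc x)
  C-pos x = ceilDiv-pos (2 * suc x) (2 * q) (s≤s z≤n) (s≤s z≤n)

  upToQ : ∀ r → 2 ≤ r → r ≤ q → Fam r
  upToQ (suc r) 2≤r r≤q = widenOn (+-monoʳ-≤ (2 * suc r) (C-pos r)) (fromII (suc r) 2≤r r≤q)

  addQ : ∀ {r} → Fam r → Fam (r + q)
  addQ {r} F = subst (λ k → FamilyOn n k (r + q)) colours (juxtaposeOn F (fromII q (s≤s (s≤s z≤n)) ≤-refl))
    where
    arith : ∀ x y c → (2 * x + c) + (2 * y + 1) ≡ 2 * (x + y) + suc c
    arith = solve-∀
    colours : (2 * r + C r) + (2 * q + 1) ≡ 2 * (r + q) + C (r + q)
    colours = trans (arith r q (C r)) (cong (2 * (r + q) +_) (sym (C-step r)))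

  module _ (firstAbove : Fam (suc q)) where
    allR : ∀ r → 2 ≤ r → Fam r
    allR = <-rec (λ r → 2 ≤ r → Fam r) build
      where
      build : ∀ r → (∀ {r₀} → r₀ < r → 2 ≤ r₀ → Fam r₀) → 2 ≤ r → Fam r
      build r rec 2≤r with r ≤? q
      ... | yes r≤q = upToQ r 2≤r r≤q
      ... | no r≰q with m≤n⇒∃[o]m+o≡n (≰⇒> r≰q)
      ...   | 0 , refl = subst Fam (sym (+-identityʳ (suc q))) firstAbove
      ...   | suc o , refl = subst Fam r₀+q≡r (addQ (rec r₀<r (s≤s (s≤s z≤n))))
        where
        r₀+q≡r : 2 + o + q ≡ suc q + suc o
        r₀+q≡r = trans (+-comm (2 + o) q) (+-suc q (suc o))
        r₀<r : 2 + o < suc q + suc o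
        r₀<r = <-≤-trans (m<m+n (2 + o) (s≤s z≤n)) (≤-reflexive r₀+q≡r)

-- The case r = q + 1: for q = 2 the explicit pentagon family; for q ≥ 3 two
-- families from part (ii), with 2 and q - 1 layers, on 5 + (2q - 1) =
-- 2(q + 1) + 2 colours, while C (q + 1) = C 1 + 1 ≥ 2.
justAbove : ∀ q₀ → ThirdPart.Fam q₀ (3 + q₀)
justAbove 0 = 2 , refl , pentagonFamily
justAbove (suc q₁) =
  widenOn colours≤ (juxtaposeOn (fromII 2 ≤-refl (s≤s (s≤s z≤n))) (fromII (2 + q₁) (s≤s (s≤s z≤n)) (n≤1+n _)))
  where
  open ThirdPart (suc q₁)
  arith : ∀ x → (2 * 2 + 1) + (2 * (2 + x) + 1) ≡ 2 * (4 + x) + 2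
  arith = solve-∀
  2≤C : 2 ≤ C (4 + q₁)
  2≤C = ≤-trans (s≤s (C-pos 0)) (≤-reflexive (sym (C-step 1)))
  colours≤ : (2 * 2 + 1) + (2 * (2 + q₁) + 1) ≤ 2 * (4 + q₁) + C (4 + q₁)
  colours≤ = ≤-trans (≤-reflexive (arith q₁)) (+-monoʳ-≤ (2 * (4 + q₁)) 2≤C)

-- The triangle: r disjoint copies of a rainbow triangle use 3r = 2r + ⌈2r/2⌉ colours.
triangleFamily : ∀ r → FamilyOn 3 (2 * r + ceilDiv (2 * r) 2) r
triangleFamily r = widenOn bound (0 , refl , copies triangle r)
  where
  split : ∀ x → x * 3 ≡ 2 * x + x
  split = solve-∀
  r≤half : r ≤ ceilDiv (2 * r) 2
  r≤half = ≤-trans (≤-reflexive (sym (m*n/n≡m r 2)))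
                   (/-monoˡ-≤ 2 (≤-trans (≤-reflexive (*-comm r 2)) (m≤m+n (2 * r) 1)))
  bound : r * 3 ≤ 2 * r + ceilDiv (2 * r) 2
  bound = ≤-trans (≤-reflexive (split r)) (+-monoʳ-≤ (2 * r) r≤half)

oddCyclesCeil : ∀ n r → 3 ≤ n → 2 ≤ r → n % 2 ≡ 1 →
                StarColorable (Cycle n) (2 * r + ceilDiv (2 * r) (n ∸ 1)) r
oddCyclesCeil n r 3≤n 2≤r odd =
  realiseOn (subst (λ N → FamilyOn N (2 * r + ceilDiv (2 * r) (N ∸ 1)) r) (sym n≡1+2q)
                   (byHalf (n / 2) (subst (3 ≤_) n≡1+2q 3≤n)))
  where
  n≡1+2q : n ≡ suc (2 * (n / 2))
  n≡1+2q = trans (oddForm n odd) (cong suc (*-comm (n / 2) 2))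
  byHalf : ∀ q → 3 ≤ suc (2 * q) → FamilyOn (suc (2 * q)) (2 * r + ceilDiv (2 * r) (2 * q)) r
  byHalf 0 (s≤s ())
  byHalf 1 _ = triangleFamily r
  byHalf (suc (suc q₀)) _ = ThirdPart.allR q₀ (justAbove q₀) r 2≤r

theorem5 : (n r : ℕ) → 3 ≤ n → 2 ≤ r →
    ((n % 2 ≡ 0 → 4 ≤ n → StarColorable (Cycle n) (2 * r) r)
    × (n % 2 ≡ 1 → 2 * r + 1 ≤ n → StarColorable (Cycle n) (2 * r + 1) r)
    × (n % 2 ≡ 1 → StarColorable (Cycle n) (2 * r + ceilDiv (2 * r) (n ∸ 1)) r))
theorem5 n r 3≤n 2≤r = evenCycles n r 2≤r , oddCycles n r 2≤r , oddCyclesCeil n r 3≤n 2≤r
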